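{- Let $H=(T,U)$ be a modular graph with orbits $Q_1,\dots,Q_k$, and let $H'=H/Q_1$ be the (multi)graph obtained by contracting the edges of $Q_1$, identifying edges of $U-Q_1$ with their images. Then $Q_2,\dots,Q_k$ are precisely the orbits of $H'$.
   Context: Graphs are finite and connected; $d^G$ is the path metric. $G$ is modular if every three nodes $x,y,z$ have a median $v$ (a node lying on shortest paths between each pair among $x,y,z$, i.e. $d^G(a,v)+d^G(v,b)=d^G(a,b)$ for each pair $a,b$ of them). For a graph possibly with parallel edges, two edges are mates if they are opposite edges of some 4-circuit or are parallel; edges are projective if they are connected by a sequence of edges in which consecutive edges are mates; an orbit is a maximal set of mutually projective edges. (The contracted graph $H'$ is modular.) -}

module Defs where

open import Data.Nat using (ℕ; zero; suc; _+_; _≤_)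
open import Data.Fin using (Fin)
open import Data.Product using (Σ; ∃; ∃-syntax; _×_; _,_; proj₁; proj₂)
open import Data.Product using () renaming (map to map×)
open import Data.Sum using (_⊎_)
open import Relation.Nullary using (¬_)
open import Relation.Unary using (Pred)
open import Relation.Binary.PropositionalEquality using (_≡_; _≢_)
open import Relation.Binary.Construct.Closure.ReflexiveTransitive using (Star)
open import Function.Bundles using (_⇔_)
open import Level using (0ℓ)

-- A finite multigraph (parallel edges and loops allowed):
-- vertices Fin nV, edges Fin nE, each edge has a pair of endpoints
-- (orientation irrelevant, see Link).
record MultiGraph : Set where
  field
    nV   : ℕ
    nE   : ℕ
    ends : Fin nE → Fin nV × Fin nV
open MultiGraph public

Vertex : MultiGraph → Set
Vertex G = Fin (nV G)

Edge : MultiGraph → Set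
Edge G = Fin (nE G)

Link : (G : MultiGraph) → Edge G → Vertex G → Vertex G → Set
Link G e x y = (ends G e ≡ (x , y)) ⊎ (ends G e ≡ (y , x))

data Walk (G : MultiGraph) : Vertex G → Vertex G → ℕ → Set where
  nil  : ∀ {x} → Walk G x x 0
  cons : ∀ {x y z k} (e : Edge G) → Link G e x y → Walk G y z k → Walk G x z (suc k)

IsDist : (G : MultiGraph) → Vertex G → Vertex G → ℕ → Set
IsDist G x y k = Walk G x y k × (∀ j → Walk G x y j → k ≤ j)

Connected : MultiGraph → Set
Connected G = ∀ x y → ∃[ k ] Walk G x y k

Simple : MultiGraph → Set
Simple G = (∀ e → proj₁ (ends G e) ≢ proj₂ (ends G e))
         × (∀ e f x y → Link G e x y → Link G f x y → e ≡ f)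

Between : (G : MultiGraph) → Vertex G → Vertex G → Vertex G → Set
Between G a v b = ∃[ p ] ∃[ q ] (IsDist G a v p × IsDist G v b q × IsDist G a b (p + q))

IsMedian : (G : MultiGraph) → Vertex G → Vertex G → Vertex G → Vertex G → Set
IsMedian G x y z v = Between G x v y × Between G y v z × Between G x v z

Modular : MultiGraph → Set
Modular G = Simple G × Connected G × (∀ x y z → ∃[ v ] IsMedian G x y z v)

Opposite : (G : MultiGraph) → Edge G → Edge G → Set
Opposite G e f =
  ∃[ v0 ] ∃[ v1 ] ∃[ v2 ] ∃[ v3 ] ∃[ g ] ∃[ h ]
    ( (v0 ≢ v1) × (v0 ≢ v2) × (v0 ≢ v3) × (v1 ≢ v2) × (v1 ≢ v3) × (v2 ≢ v3)
    × Link G e v0 v1 × Link G g v1 v2 × Link G f v2 v3 × Link G h v3 v0 )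

Parallel : (G : MultiGraph) → Edge G → Edge G → Set
Parallel G e f = (e ≢ f) × ∃[ x ] ∃[ y ] (Link G e x y × Link G f x y)

Mates : (G : MultiGraph) → Edge G → Edge G → Set
Mates G e f = Opposite G e f ⊎ Parallel G e f

Projective : (G : MultiGraph) → Edge G → Edge G → Set
Projective G = Star (Mates G)

IsOrbit : (G : MultiGraph) → Pred (Edge G) 0ℓ → Set
IsOrbit G Q = (∃[ e ] Q e) × (∀ e f → Q e → (Q f ⇔ Projective G e f))

-- H' together with φ : V(H) → V(H') and ι : E(H') → E(H) is the contraction
-- H/Q: φ is surjective and identifies exactly the vertices joined by a path of
-- Q-edges; ι is a bijection onto the edges of H not in Q (edges of H' are
-- identified with their preimages), and endpoints of ι e' are mapped by φ to
-- the endpoints of e'.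
QLink : (H : MultiGraph) → Pred (Edge H) 0ℓ → Vertex H → Vertex H → Set
QLink H Q x y = ∃[ e ] (Q e × Link H e x y)

record IsContraction (H : MultiGraph) (Q : Pred (Edge H) 0ℓ) (H' : MultiGraph)
                     (φ : Vertex H → Vertex H') (ι : Edge H' → Edge H) : Set where
  field
    φ-surj   : ∀ y → ∃[ x ] φ x ≡ y
    φ-kernel : ∀ x y → (φ x ≡ φ y) ⇔ Star (QLink H Q) x y
    ι-inj    : ∀ e f → ι e ≡ ι f → e ≡ f
    ι-out    : ∀ e → ¬ Q (ι e)
    ι-onto   : ∀ e → ¬ Q e → ∃[ e' ] ι e' ≡ e
    ι-ends   : ∀ e → ends H' e ≡ map× φ φ (ends H (ι e))

-- Since Q₁ is closed under mates, the quadrangle condition of the modular graph H shows that every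
-- geodesic between two vertices of one Q₁-component runs inside Q₁: components are convex, and a
-- vertex next to a component reaches all of it through that neighbour. Sliding an edge through
-- 4-circuits along geodesics inside the components then shows that any two edges joining the same
-- two components are projective. Hence mates of H′ lift to projective edges of H: parallel edges
-- directly, and a 4-circuit of H′ because any lift of it through its four components can be
-- shortened (again by the quadrangle condition) until it is a 4-circuit of H. Conversely, two
-- opposite edges of H outside Q₁ stay opposite in H′, or become parallel when the 4-circuit
-- collapses. So projectivity in H′ is projectivity in H restricted to edges outside Q₁.

module Submission where

open import Defs
open import Level using (0ℓ)
open import Function using (_∘_; id)
open import Function.Bundles using (_⇔_; mk⇔; Equivalence)
open import Relation.Unary using (Pred; Decidable)
open import Relation.Nullary using (¬_; Dec; yes; no)
open import Relation.Binary.Definitions using (tri<; tri≈; tri>)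
open import Relation.Nullary.Decidable using (map′; _×-dec_; _⊎-dec_)
open import Data.Empty using (⊥; ⊥-elim)
open import Data.Product using (_×_; ∃-syntax; _,_; proj₁; proj₂; map)
open import Data.Product.Properties using (≡-dec; ,-injectiveˡ; ,-injectiveʳ)
open import Data.Sum using (_⊎_; inj₁; inj₂; [_,_]′)
open import Data.Nat using (ℕ; zero; suc; _+_; _≤_; _<_; s≤s)
open import Data.Nat.Properties
open import Data.Nat.Induction using (<-rec)
open import Data.Nat.Solver using (module +-*-Solver)
import Data.Fin as Fin
open import Data.Fin.Properties using (any?)
open import Relation.Binary.PropositionalEquality
open import Relation.Binary.Construct.Closure.ReflexiveTransitive using (Star; ε; _◅_; _◅◅_; reverse)

least-witness : {P : Pred ℕ 0ℓ} → Decidable P → ∀ {n} → P n → ∃[ k ] (P k × ∀ j → P j → k ≤ j)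
least-witness {P} P? {n} = <-rec (λ n → P n → ∃[ k ] (P k × ∀ j → P j → k ≤ j)) search n
  where
  search : ∀ n → (∀ {m} → m < n → P m → ∃[ k ] (P k × ∀ j → P j → k ≤ j)) →
           P n → ∃[ k ] (P k × ∀ j → P j → k ≤ j)
  search n smaller pn with anyUpTo? P? n
  ... | yes (m , m<n , pm) = smaller m<n pm
  ... | no none = n , pn , λ j pj → ≮⇒≥ λ j<n → none (j , j<n , pj)

n+n≢1 : ∀ n → n + n ≢ 1
n+n≢1 (suc n) eq = 1+n≢0 (trans (sym (+-suc n n)) (suc-injective eq))

n+n≡2⇒n≡1 : ∀ n → n + n ≡ 2 → n ≡ 1
n+n≡2⇒n≡1 (suc zero) _ = refl
n+n≡2⇒n≡1 (suc (suc n)) eq = ⊥-elim (1+n≢0 (suc-injective (trans (sym (+-suc (suc n) (suc n))) (suc-injective eq))))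

differ-by-one : ∀ {m n} → m ≤ suc n → n ≤ suc m → m ≢ n → m ≡ suc n ⊎ n ≡ suc m
differ-by-one {m} {n} m≤1+n n≤1+m m≢n with <-cmp m n
... | tri< m<n _ _ = inj₂ (≤-antisym n≤1+m m<n)
... | tri≈ _ m≡n _ = ⊥-elim (m≢n m≡n)
... | tri> _ _ n<m = inj₁ (≤-antisym m≤1+n n<m)

separated-by : ∀ {A B : Set} (f : A → B) {a b m n} → f a ≡ m → f b ≡ n → m ≢ n → a ≢ b
separated-by f fa≡m fb≡n m≢n refl = m≢n (trans (sym fa≡m) fb≡n)

2+n≢n : ∀ n → suc (suc n) ≢ n
2+n≢n n = ≢-sym (m≢1+n+m n)

zero-or-suc : ∀ n → n ≡ 0 ⊎ ∃[ m ] n ≡ suc m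
zero-or-suc zero = inj₁ refl
zero-or-suc (suc m) = inj₂ (m , refl)

-- Adding the two inequalities gives b + b ≤ e + e.
crossed-sums : ∀ a b c e → a + b ≤ c + e → c + b ≤ a + e → b ≤ e
crossed-sums a b c e ab≤ce cb≤ae = ≮⇒≥ λ e<b → <⇒≱ (+-mono-< e<b e<b) b+b≤e+e
  where
  open +-*-Solver
  b+b≤e+e : b + b ≤ e + e
  b+b≤e+e = +-cancelˡ-≤ (a + c) _ _
    (subst₂ _≤_ (solve 3 (λ a b c → (a :+ b) :+ (c :+ b) := (a :+ c) :+ (b :+ b)) refl a b c)
                (solve 3 (λ a c e → (c :+ e) :+ (a :+ e) := (a :+ c) :+ (e :+ e)) refl a c e)
                (+-mono-≤ ab≤ce cb≤ae))

-- Walks, distances and mates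

module GraphFacts (G : MultiGraph) where

  link-sym : ∀ e {x y} → Link G e x y → Link G e y x
  link-sym e (inj₁ p) = inj₂ p
  link-sym e (inj₂ p) = inj₁ p

  _++ʷ_ : ∀ {x y z k m} → Walk G x y k → Walk G y z m → Walk G x z (k + m)
  nil ++ʷ w = w
  cons e l v ++ʷ w = cons e l (v ++ʷ w)

  reverseʷ : ∀ {x y k} → Walk G x y k → Walk G y x k
  reverseʷ nil = nil
  reverseʷ {k = suc k} (cons e l w) = subst (Walk G _ _) (+-comm k 1) (reverseʷ w ++ʷ cons e (link-sym e l) nil)

  link-endpoint : ∀ e {x y u w} → Link G e x y → Link G e u w → x ≡ u ⊎ x ≡ w
  link-endpoint e (inj₁ p) (inj₁ q) = inj₁ (,-injectiveˡ (trans (sym p) q))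
  link-endpoint e (inj₁ p) (inj₂ q) = inj₂ (,-injectiveˡ (trans (sym p) q))
  link-endpoint e (inj₂ p) (inj₁ q) = inj₂ (,-injectiveʳ (trans (sym p) q))
  link-endpoint e (inj₂ p) (inj₂ q) = inj₁ (,-injectiveʳ (trans (sym p) q))

  walk-zero : ∀ {x y} → Walk G x y 0 → x ≡ y
  walk-zero nil = refl

  walk-one : ∀ {x y} → Walk G x y 1 → ∃[ e ] Link G e x y
  walk-one (cons e l nil) = e , l

  link? : ∀ e x y → Dec (Link G e x y)
  link? e x y = ends G e ≟ᵥ (x , y) ⊎-dec ends G e ≟ᵥ (y , x)
    where
    _≟ᵥ_ : (p q : Vertex G × Vertex G) → Dec (p ≡ q)
    _≟ᵥ_ = ≡-dec Fin._≟_ Fin._≟_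

  walk? : ∀ k x y → Dec (Walk G x y k)
  walk? zero x y = map′ (λ { refl → nil }) walk-zero (x Fin.≟ y)
  walk? (suc k) x y =
    map′ (λ (e , z , l , w) → cons e l w) (λ { (cons e l w) → e , _ , l , w })
         (any? λ e → any? λ z → link? e x z ×-dec walk? k z y)

  module Distance (connected : Connected G) where

    abstract
      d : Vertex G → Vertex G → ℕ
      d x y = proj₁ (least-witness (λ k → walk? k x y) (proj₂ (connected x y)))

      d-isDist : ∀ x y → IsDist G x y (d x y)
      d-isDist x y = proj₂ (least-witness (λ k → walk? k x y) (proj₂ (connected x y)))

    d-walk : ∀ x y → Walk G x y (d x y)
    d-walk x y = proj₁ (d-isDist x y)

    d-minimal : ∀ {x y k} → Walk G x y k → d x y ≤ k
    d-minimal {x} {y} w = proj₂ (d-isDist x y) _ w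

    d-unique : ∀ {x y k} → IsDist G x y k → d x y ≡ k
    d-unique (w , minimal) = ≤-antisym (d-minimal w) (minimal _ (d-walk _ _))

    d≡0⇒≡ : ∀ {x y} → d x y ≡ 0 → x ≡ y
    d≡0⇒≡ {x} {y} eq = walk-zero (subst (Walk G x y) eq (d-walk x y))

    d-refl : ∀ x → d x x ≡ 0
    d-refl x = n≤0⇒n≡0 (d-minimal {x} nil)

    d-sym : ∀ x y → d x y ≡ d y x
    d-sym x y = ≤-antisym (d-minimal (reverseʷ (d-walk y x))) (d-minimal (reverseʷ (d-walk x y)))

    d-triangle : ∀ x y z → d x z ≤ d x y + d y z
    d-triangle x y z = d-minimal (d-walk x y ++ʷ d-walk y z)

    d≡1⇒link : ∀ {x y} → d x y ≡ 1 → ∃[ e ] Link G e x y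
    d≡1⇒link {x} {y} eq = walk-one (subst (Walk G x y) eq (d-walk x y))

    link⇒d≤1 : ∀ e {x y} → Link G e x y → d x y ≤ 1
    link⇒d≤1 e l = d-minimal (cons e l nil)

    d-link-step : ∀ e {y z} x → Link G e y z → d x z ≤ suc (d x y)
    d-link-step e {y} {z} x l = begin
      d x z           ≤⟨ d-triangle x y z ⟩
      d x y + d y z   ≤⟨ +-monoʳ-≤ (d x y) (link⇒d≤1 e l) ⟩
      d x y + 1       ≡⟨ +-comm (d x y) 1 ⟩
      suc (d x y)     ∎
      where open ≤-Reasoning

    geodesic-first-step : ∀ {x y n} → d x y ≡ suc n → ∃[ x′ ] ∃[ e ] (Link G e x x′ × d x′ y ≡ n)
    geodesic-first-step {x} {y} {n} eq with subst (Walk G x y) eq (d-walk x y)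
    ... | cons {y = x′} e l w = x′ , e , l , ≤-antisym (d-minimal w) (≤-pred lower)
      where
      lower : suc n ≤ suc (d x′ y)
      lower = begin
        suc n          ≡⟨ sym eq ⟩
        d x y          ≡⟨ d-sym x y ⟩
        d y x          ≤⟨ d-link-step e y (link-sym e l) ⟩
        suc (d y x′)   ≡⟨ cong suc (d-sym y x′) ⟩
        suc (d x′ y)   ∎
        where open ≤-Reasoning

    between⇒d : ∀ {a v b} → Between G a v b → d a v + d v b ≡ d a b
    between⇒d (_ , _ , av , vb , ab) = trans (cong₂ _+_ (d-unique av) (d-unique vb)) (sym (d-unique ab))

  record FourCircuit (v0 v1 v2 v3 : Vertex G) (e g f h : Edge G) : Set where
    constructor fourCircuit
    field
      v0≢v1 : v0 ≢ v1
      v0≢v2 : v0 ≢ v2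
      v0≢v3 : v0 ≢ v3
      v1≢v2 : v1 ≢ v2
      v1≢v3 : v1 ≢ v3
      v2≢v3 : v2 ≢ v3
      link-e : Link G e v0 v1
      link-g : Link G g v1 v2
      link-f : Link G f v2 v3
      link-h : Link G h v3 v0

  circuit-opposite : ∀ {v0 v1 v2 v3 e g f h} → FourCircuit v0 v1 v2 v3 e g f h → Opposite G e f
  circuit-opposite {v0} {v1} {v2} {v3} {g = g} {h = h} (fourCircuit n01 n02 n03 n12 n13 n23 le lg lf lh) =
    v0 , v1 , v2 , v3 , g , h , n01 , n02 , n03 , n12 , n13 , n23 , le , lg , lf , lh

  circuit-rotate : ∀ {v0 v1 v2 v3 e g f h} → FourCircuit v0 v1 v2 v3 e g f h → FourCircuit v1 v2 v3 v0 g f h e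
  circuit-rotate (fourCircuit n01 n02 n03 n12 n13 n23 le lg lf lh) =
    fourCircuit n12 n13 (≢-sym n01) n23 (≢-sym n02) (≢-sym n03) lg lf lh le

  mates-sym : ∀ {e f} → Mates G e f → Mates G f e
  mates-sym (inj₁ (v0 , v1 , v2 , v3 , g , h , n01 , n02 , n03 , n12 , n13 , n23 , le , lg , lf , lh)) =
    inj₁ (v2 , v3 , v0 , v1 , h , g , n23 , ≢-sym n02 , ≢-sym n12 , ≢-sym n03 , ≢-sym n13 , n01 , lf , lh , le , lg)
  mates-sym (inj₂ (e≢f , x , y , le , lf)) = inj₂ (≢-sym e≢f , x , y , lf , le)

  projective-sym : ∀ {e f} → Projective G e f → Projective G f e
  projective-sym = reverse mates-sym

MateClosed : (G : MultiGraph) → Pred (Edge G) 0ℓ → Set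
MateClosed G Q = ∀ {e f} → Q e → Mates G e f → Q f

orbit-mate-closed : ∀ {G Q} → IsOrbit G Q → MateClosed G Q
orbit-mate-closed (_ , orbit) {e} {f} qe m = Equivalence.from (orbit e f qe) (m ◅ ε)

projective-closed : ∀ {G Q} → MateClosed G Q → ∀ {e f} → Q e → Projective G e f → Q f
projective-closed closed qe ε = qe
projective-closed closed qe (m ◅ p) = projective-closed closed (closed qe m) p

-- Modular graphs

module ModularFacts (H : MultiGraph) (modular : Modular H) where
  open GraphFacts H public
  open Distance (proj₁ (proj₂ modular)) public

  link-irreflexive : ∀ e {x y} → Link H e x y → x ≢ y
  link-irreflexive e (inj₁ p) refl = proj₁ (proj₁ modular) e (trans (cong proj₁ p) (sym (cong proj₂ p)))
  link-irreflexive e (inj₂ p) refl = proj₁ (proj₁ modular) e (trans (cong proj₁ p) (sym (cong proj₂ p)))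

  link-unique : ∀ e f {x y} → Link H e x y → Link H f x y → e ≡ f
  link-unique e f = proj₂ (proj₁ modular) e f _ _

  d-link : ∀ e {x y} → Link H e x y → d x y ≡ 1
  d-link e {x} {y} l with d x y in eq | link⇒d≤1 e l
  ... | zero | _ = ⊥-elim (link-irreflexive e l (d≡0⇒≡ eq))
  ... | suc zero | _ = refl
  ... | suc (suc _) | s≤s ()

  median : ∀ x y z → ∃[ v ] IsMedian H x y z v
  median = proj₂ (proj₂ modular)

  -- A median v of x, u, w would be equidistant from the adjacent u and w.
  link⇒d-≢ : ∀ e {u w} x → Link H e u w → d x u ≢ d x w
  link⇒d-≢ e {u} {w} x l eq with median x u w
  ... | v , xvu , uvw , xvw = n+n≢1 (d v u) (trans (cong (d v u +_) vu≡vw) (trans (cong (_+ d v w) (d-sym v u)) uw≡1))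
    where
    vu≡vw : d v u ≡ d v w
    vu≡vw = +-cancelˡ-≡ (d x v) _ _ (trans (between⇒d xvu) (trans eq (sym (between⇒d xvw))))
    uw≡1 : d u v + d v w ≡ 1
    uw≡1 = trans (between⇒d uvw) (d-link e l)

  link-d-cases : ∀ e {u w} x → Link H e u w → d x w ≡ suc (d x u) ⊎ d x u ≡ suc (d x w)
  link-d-cases e x l =
    differ-by-one (d-link-step e x l) (d-link-step e x (link-sym e l)) (≢-sym (link⇒d-≢ e x l))

  d-common-neighbour : ∀ {v w} → v ≢ w → (∀ e → ¬ Link H e v w) →
                       ∀ {z} g h → Link H g v z → Link H h z w → d v w ≡ 2
  d-common-neighbour {v} {w} v≢w nonadjacent {z} g h lg lh with d v w in eq | d-triangle v z w
  ... | zero | _ = ⊥-elim (v≢w (d≡0⇒≡ eq))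
  ... | suc zero | _ = ⊥-elim (nonadjacent _ (proj₂ (d≡1⇒link eq)))
  ... | suc (suc zero) | _ = refl
  ... | suc (suc (suc _)) | le rewrite d-link g lg | d-link h lh with le
  ... | s≤s (s≤s ())

  -- The median of u, v, w is the common neighbour t.
  quadrangle : ∀ u {z v w} g h → Link H g z v → Link H h z w → v ≢ w → d u v ≡ d u w →
               ∃[ t ] ∃[ g′ ] ∃[ h′ ] (Link H g′ v t × Link H h′ w t × suc (d u t) ≡ d u v)
  quadrangle u {z} {v} {w} g h lg lh v≢w eq with median u v w
  ... | t , uvt , vtw , utw = t , proj₁ (d≡1⇒link vt≡1) , proj₁ (d≡1⇒link wt≡1)
                                , proj₂ (d≡1⇒link vt≡1) , proj₂ (d≡1⇒link wt≡1) , closer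
    where
    tv≡tw : d t v ≡ d t w
    tv≡tw = +-cancelˡ-≡ (d u t) _ _ (trans (between⇒d uvt) (trans eq (sym (between⇒d utw))))
    vw≡2 : d v w ≡ 2
    vw≡2 = d-common-neighbour v≢w (λ e l → link⇒d-≢ e u l eq) g h (link-sym g lg) lh
    tv≡1 : d t v ≡ 1
    tv≡1 = n+n≡2⇒n≡1 (d t v) (trans (cong₂ _+_ (d-sym t v) tv≡tw) (trans (between⇒d vtw) vw≡2))
    vt≡1 : d v t ≡ 1
    vt≡1 = trans (d-sym v t) tv≡1
    wt≡1 : d w t ≡ 1
    wt≡1 = trans (d-sym w t) (trans (sym tv≡tw) tv≡1)
    closer : suc (d u t) ≡ d u v
    closer = trans (trans (+-comm 1 (d u t)) (cong (d u t +_) (sym tv≡1))) (between⇒d uvt)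

module Contraction (H : MultiGraph) (modular : Modular H)
                   (Q : Pred (Edge H) 0ℓ) (Q-closed : MateClosed H Q)
                   (H′ : MultiGraph) (φ : Vertex H → Vertex H′) (ι : Edge H′ → Edge H)
                   (contraction : IsContraction H Q H′ φ ι) where
  open ModularFacts H modular
  open IsContraction contraction

  V : Set
  V = Vertex H

  circuit-Q : ∀ {v0 v1 v2 v3 e g f h} → FourCircuit v0 v1 v2 v3 e g f h → Q e → Q f
  circuit-Q c qe = Q-closed qe (inj₁ (circuit-opposite c))

  circuit-Q′ : ∀ {v0 v1 v2 v3 e g f h} → FourCircuit v0 v1 v2 v3 e g f h → Q g → Q h
  circuit-Q′ c = circuit-Q (circuit-rotate c)

  Q-link⇒φ≡ : ∀ e {x y} → Q e → Link H e x y → φ x ≡ φ y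
  Q-link⇒φ≡ e {x} {y} q l = Equivalence.from (φ-kernel x y) ((e , q , l) ◅ ε)

  -- Convexity of the components

  GeodesicsInQ : V → V → Set
  GeodesicsInQ x t = ∀ e a b → Link H e a b → d x a + suc (d b t) ≡ d x t → Q e

  geodesics-in-Q-refl : ∀ x → GeodesicsInQ x x
  geodesics-in-Q-refl x e a b l eq = ⊥-elim (1+n≢0 (trans (sym (+-suc (d x a) (d b x))) (trans eq (d-refl x))))

  d-via-link : ∀ x t e {a b} → Link H e a b → d x t ≤ d x a + suc (d b t)
  d-via-link x t e {a} {b} l = begin
    d x t                     ≤⟨ d-triangle x a t ⟩
    d x a + d a t             ≤⟨ +-monoʳ-≤ (d x a) (d-triangle a b t) ⟩
    d x a + (d a b + d b t)   ≡⟨ cong (λ z → d x a + (z + d b t)) (d-link e l) ⟩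
    d x a + suc (d b t)       ∎
    where open ≤-Reasoning

  geodesics-in-Q-between : ∀ {x t u} → GeodesicsInQ x t → d x u + d u t ≡ d x t → GeodesicsInQ x u
  geodesics-in-Q-between {x} {t} {u} geo xut e a b l on-xu = geo e a b l (≤-antisym on-xt (d-via-link x t e l))
    where
    on-xt : d x a + suc (d b t) ≤ d x t
    on-xt = begin
      d x a + suc (d b t)             ≤⟨ +-monoʳ-≤ (d x a) (s≤s (d-triangle b u t)) ⟩
      d x a + suc (d b u + d u t)     ≡⟨ sym (+-assoc (d x a) (suc (d b u)) (d u t)) ⟩
      d x a + suc (d b u) + d u t     ≡⟨ cong (_+ d u t) on-xu ⟩
      d x u + d u t                   ≡⟨ xut ⟩
      d x t                           ∎
      where open ≤-Reasoning

  geodesics-in-Q-retreat : ∀ {x t u} e → GeodesicsInQ x t → Link H e u t → d x t ≡ suc (d x u) → GeodesicsInQ x u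
  geodesics-in-Q-retreat {x} {t} {u} e geo l xt≡ =
    geodesics-in-Q-between geo (trans (cong (d x u +_) (d-link e l)) (trans (+-comm (d x u) 1) (sym xt≡)))

  -- Mutual induction on d x t; the last edge of an x–w geodesic is carried into Q by the square that
  -- the quadrangle condition builds on it and on f.
  geodesics-in-Q-advance : ∀ x n {t w} f → d x t ≡ n → GeodesicsInQ x t → Q f → Link H f t w →
                           d x w ≡ suc n → GeodesicsInQ x w
  last-edge-in-Q : ∀ x n {t w} f → d x t ≡ n → GeodesicsInQ x t → Q f → Link H f t w → d x w ≡ suc n →
                   ∀ {w′} e′ → Link H e′ w′ w → d x w′ ≡ n → GeodesicsInQ x w′ × Q e′
  last-edge-in-Q x n {t} {w} f xt≡n geo qf lf xw≡ {w′} e′ l′ xw′≡n with w′ Fin.≟ t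
  ... | yes refl = geo , subst Q (link-unique f e′ lf l′) qf
  last-edge-in-Q x zero {t} f xt≡n geo qf lf xw≡ e′ l′ xw′≡n | no w′≢t =
    ⊥-elim (w′≢t (trans (sym (d≡0⇒≡ xw′≡n)) (d≡0⇒≡ xt≡n)))
  last-edge-in-Q x (suc n) {t} {w} f xt≡n geo qf lf xw≡ {w′} e′ l′ xw′≡n | no w′≢t =
    close-square (quadrangle x f e′ (link-sym f lf) (link-sym e′ l′) (≢-sym w′≢t) (trans xt≡n (sym xw′≡n)))
    where
    close-square : ∃[ s ] ∃[ g′ ] ∃[ h′ ] (Link H g′ t s × Link H h′ w′ s × suc (d x s) ≡ d x t) →
                   GeodesicsInQ x w′ × Q e′
    close-square (s , g′ , h′ , lg′ , lh′ , xs<xt) =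
      geodesics-in-Q-advance x n h′ xs≡n geo-s (circuit-Q square qf) (link-sym h′ lh′) xw′≡n , circuit-Q′ square qg′
      where
      xs≡n : d x s ≡ n
      xs≡n = suc-injective (trans xs<xt xt≡n)
      square : FourCircuit w t s w′ f g′ h′ e′
      square = fourCircuit (≢-sym (link-irreflexive f lf)) (separated-by (d x) xw≡ xs≡n (2+n≢n n))
                           (≢-sym (link-irreflexive e′ l′)) (link-irreflexive g′ lg′) (≢-sym w′≢t)
                           (link-irreflexive h′ (link-sym h′ lh′))
                           (link-sym f lf) lg′ (link-sym h′ lh′) l′
      qg′ : Q g′
      qg′ = geo g′ s t (link-sym g′ lg′) (trans (cong (λ z → d x s + suc z) (d-refl t)) (trans (+-comm (d x s) 1) xs<xt))
      geo-s : GeodesicsInQ x s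
      geo-s = geodesics-in-Q-retreat g′ geo (link-sym g′ lg′) (sym xs<xt)

  geodesics-in-Q-advance x n {t} {w} f xt≡n geo qf lf xw≡ e a b l on-geodesic with d b w in bw≡
  ... | zero with d≡0⇒≡ bw≡
  ...   | refl = proj₂ (last-edge-in-Q x n f xt≡n geo qf lf xw≡ e l xa≡n)
    where
    xa≡n : d x a ≡ n
    xa≡n = suc-injective (trans (sym (+-comm (d x a) 1)) (trans on-geodesic xw≡))
  geodesics-in-Q-advance x n {t} {w} f xt≡n geo qf lf xw≡ e a b l on-geodesic | suc m =
    via-predecessor (geodesic-first-step (trans (d-sym w b) bw≡))
    where
    xa+1+m≡n : d x a + suc m ≡ n
    xa+1+m≡n = suc-injective (trans (sym (+-suc (d x a) (suc m))) (trans on-geodesic xw≡))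
    via-predecessor : ∃[ w′ ] ∃[ e′ ] (Link H e′ w w′ × d w′ b ≡ m) → Q e
    via-predecessor (w′ , e′ , l′ , w′b≡m) =
      proj₁ (last-edge-in-Q x n f xt≡n geo qf lf xw≡ e′ (link-sym e′ l′) xw′≡n) e a b l (trans on-xw′ (sym xw′≡n))
      where
      on-xw′ : d x a + suc (d b w′) ≡ n
      on-xw′ = trans (cong (λ z → d x a + suc z) (trans (d-sym b w′) w′b≡m)) xa+1+m≡n
      xw′≡n : d x w′ ≡ n
      xw′≡n = ≤-antisym (≤-trans (d-via-link x w′ e l) (≤-reflexive on-xw′))
                        (≤-pred (subst (_≤ suc (d x w′)) xw≡ (d-link-step e′ x (link-sym e′ l′))))

  geodesics-in-Q-along : ∀ {x t y} → GeodesicsInQ x t → Star (QLink H Q) t y → GeodesicsInQ x y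
  geodesics-in-Q-along geo ε = geo
  geodesics-in-Q-along {x} {t} geo ((e , q , l) ◅ rest) with link-d-cases e x l
  ... | inj₁ away = geodesics-in-Q-along (geodesics-in-Q-advance x (d x t) e refl geo q l away) rest
  ... | inj₂ back = geodesics-in-Q-along (geodesics-in-Q-retreat e geo (link-sym e l) back) rest

  φ≡⇒geodesics-in-Q : ∀ {x y} → φ x ≡ φ y → GeodesicsInQ x y
  φ≡⇒geodesics-in-Q {x} {y} eq = geodesics-in-Q-along (geodesics-in-Q-refl x) (Equivalence.to (φ-kernel x y) eq)

  φ≡⇒Q : ∀ e {a b} → Link H e a b → φ a ≡ φ b → Q e
  φ≡⇒Q e {a} {b} l eq =
    φ≡⇒geodesics-in-Q eq e a b l (trans (cong₂ (λ p q → p + suc q) (d-refl a) (d-refl b)) (sym (d-link e l)))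

  geodesics-in-Q⇒φ≡ : ∀ x n {v} → d x v ≡ n → GeodesicsInQ x v → φ x ≡ φ v
  geodesics-in-Q⇒φ≡ x zero xv≡0 geo = cong φ (d≡0⇒≡ xv≡0)
  geodesics-in-Q⇒φ≡ x (suc n) {v} xv≡ geo = last-step (geodesic-first-step (trans (d-sym v x) xv≡))
    where
    last-step : ∃[ v′ ] ∃[ e ] (Link H e v v′ × d v′ x ≡ n) → φ x ≡ φ v
    last-step (v′ , e , l , v′x≡n) =
      trans (geodesics-in-Q⇒φ≡ x n xv′≡n (geodesics-in-Q-retreat e geo (link-sym e l) (trans xv≡ (cong suc (sym xv′≡n)))))
            (Q-link⇒φ≡ e qe (link-sym e l))
      where
      xv′≡n : d x v′ ≡ n
      xv′≡n = trans (d-sym x v′) v′x≡n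
      qe : Q e
      qe = geo e v′ v (link-sym e l) (trans (cong₂ (λ p r → p + suc r) xv′≡n (d-refl v)) (trans (+-comm n 1) (sym xv≡)))

  component-convex : ∀ {x y v} → φ x ≡ φ y → d x v + d v y ≡ d x y → φ x ≡ φ v
  component-convex {x} {y} {v} eq xvy = geodesics-in-Q⇒φ≡ x (d x v) refl (geodesics-in-Q-between (φ≡⇒geodesics-in-Q eq) xvy)

  -- Edges between two components

  d-through-gate : ∀ e {s b₀ b} → Link H e s b₀ → φ s ≢ φ b₀ → φ b₀ ≡ φ b → d s b ≡ suc (d b₀ b)
  d-through-gate e {s} {b₀} {b} l s∉ b∈ with link-d-cases e b l
  ... | inj₁ s-closer = ⊥-elim (s∉ (sym (component-convex b∈ s-between)))
    where
    s-between : d b₀ s + d s b ≡ d b₀ b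
    s-between = trans (cong₂ _+_ (trans (d-sym b₀ s) (d-link e l)) (d-sym s b)) (trans (sym s-closer) (d-sym b b₀))
  ... | inj₂ b₀-closer = trans (d-sym s b) (trans b₀-closer (cong suc (d-sym b b₀)))

  -- Induction on d b₀ b, pushing the edge b–x towards b₀ through squares whose opposite sides lie in Q.
  leaving-component-not-closer : ∀ k e f {s b₀ b x} → Link H e s b₀ → φ s ≢ φ b₀ → φ b₀ ≡ φ b → d b₀ b ≡ k →
                                 Link H f b x → φ x ≢ φ b₀ → φ x ≢ φ s → d s b ≢ suc (d s x)
  leaving-component-not-closer zero e f {s} {x = x} l s∉ b∈ b₀b≡0 lf x∉ x≁s sb≡ with d≡0⇒≡ b₀b≡0
  ... | refl = x≁s (sym (cong φ (d≡0⇒≡ (suc-injective 1+sx≡1))))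
    where
    1+sx≡1 : suc (d s x) ≡ 1
    1+sx≡1 = trans (sym sb≡) (trans (d-through-gate e l s∉ b∈) (cong suc b₀b≡0))
  leaving-component-not-closer (suc k) e f {s} {b₀} {b} {x} l s∉ b∈ b₀b≡ lf x∉ x≁s sb≡ =
    step (geodesic-first-step (trans (d-sym b b₀) b₀b≡))
    where
    sb≡2+k : d s b ≡ suc (suc k)
    sb≡2+k = trans (d-through-gate e l s∉ b∈) (cong suc b₀b≡)
    sx≡1+k : d s x ≡ suc k
    sx≡1+k = suc-injective (trans (sym sb≡) sb≡2+k)
    step : ∃[ b′ ] ∃[ g ] (Link H g b b′ × d b′ b₀ ≡ k) → ⊥
    step (b′ , g , lg , b′b₀≡k) = push (quadrangle s f g lf lg x≢b′ (trans sx≡1+k (sym sb′≡1+k)))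
      where
      b₀b′≡k : d b₀ b′ ≡ k
      b₀b′≡k = trans (d-sym b₀ b′) b′b₀≡k
      b′∈ : φ b₀ ≡ φ b′
      b′∈ = component-convex b∈ (trans (cong₂ _+_ b₀b′≡k (d-link g (link-sym g lg))) (trans (+-comm k 1) (sym b₀b≡)))
      sb′≡1+k : d s b′ ≡ suc k
      sb′≡1+k = trans (d-through-gate e l s∉ b′∈) (cong suc b₀b′≡k)
      x≢b′ : x ≢ b′
      x≢b′ x≡b′ = x∉ (trans (cong φ x≡b′) (sym b′∈))
      push : ∃[ t ] ∃[ g₁ ] ∃[ h₁ ] (Link H g₁ x t × Link H h₁ b′ t × suc (d s t) ≡ d s x) → ⊥
      push (t , g₁ , h₁ , lg₁ , lh₁ , st<sx) =
        leaving-component-not-closer k e h₁ l s∉ b′∈ b₀b′≡k lh₁ (x∉ ∘ trans x~t) (x≁s ∘ trans x~t)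
                                     (trans sb′≡1+k (cong suc (sym st≡k)))
        where
        st≡k : d s t ≡ k
        st≡k = suc-injective (trans st<sx sx≡1+k)
        square : FourCircuit b′ b x t g f g₁ h₁
        square = fourCircuit (≢-sym (link-irreflexive g lg)) (≢-sym x≢b′) (link-irreflexive h₁ lh₁)
                             (link-irreflexive f lf) (separated-by (d s) sb≡2+k st≡k (2+n≢n k)) (link-irreflexive g₁ lg₁)
                             (link-sym g lg) lf lg₁ (link-sym h₁ lh₁)
        x~t : φ x ≡ φ t
        x~t = Q-link⇒φ≡ g₁ (circuit-Q square (φ≡⇒Q g lg (trans (sym b∈) b′∈))) lg₁

  d-leaving-component : ∀ e f {s b₀ b x} → Link H e s b₀ → φ s ≢ φ b₀ → φ b₀ ≡ φ b →
                        Link H f b x → φ x ≢ φ b₀ → φ x ≢ φ s → d s x ≡ suc (d s b)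
  d-leaving-component e f {s} {b₀} {b} l s∉ b∈ lf x∉ x≁s with link-d-cases f s lf
  ... | inj₁ further = further
  ... | inj₂ closer = ⊥-elim (leaving-component-not-closer (d b₀ b) e f l s∉ b∈ refl lf x∉ x≁s closer)

  -- Induction on d x x′, sliding e along a geodesic from x to x′ inside the component of x.
  links-between-components-projective :
    ∀ k e f {x y x′ y′} → Link H e x y → Link H f x′ y′ → φ x ≡ φ x′ → φ y ≡ φ y′ → φ x ≢ φ y →
    d x x′ ≡ k → Projective H e f
  links-between-components-projective zero e f {x} {y} {x′} {y′} le lf x~x′ y~y′ x≁y xx′≡0 with d≡0⇒≡ xx′≡0
  ... | refl with d≡0⇒≡ (suc-injective (trans (sym (d-through-gate e le x≁y y~y′)) (d-link f lf)))
  ...   | refl = subst (Projective H e) (link-unique e f le lf) ε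
  links-between-components-projective (suc k) e f {x} {y} {x′} {y′} le lf x~x′ y~y′ x≁y xx′≡ =
    step (geodesic-first-step (trans (d-sym x′ x) xx′≡))
    where
    yx′≡2+k : d y x′ ≡ suc (suc k)
    yx′≡2+k = trans (d-through-gate e (link-sym e le) (≢-sym x≁y) x~x′) (cong suc xx′≡)
    x′≁y′ : φ x′ ≢ φ y′
    x′≁y′ eq = x≁y (trans x~x′ (trans eq (sym y~y′)))
    yy′≡1+k : d y y′ ≡ suc k
    yy′≡1+k = suc-injective (trans (sym (trans (d-through-gate f lf x′≁y′ (sym y~y′)) (cong suc (d-sym y′ y))))
                                   (trans (d-sym x′ y) yx′≡2+k))
    step : ∃[ x₁ ] ∃[ g ] (Link H g x′ x₁ × d x₁ x ≡ k) → Projective H e f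
    step (x₁ , g , lg , x₁x≡k) = slide (quadrangle y f g lf lg y′≢x₁ (trans yy′≡1+k (sym yx₁≡1+k)))
      where
      xx₁≡k : d x x₁ ≡ k
      xx₁≡k = trans (d-sym x x₁) x₁x≡k
      x~x₁ : φ x ≡ φ x₁
      x~x₁ = component-convex x~x′ (trans (cong₂ _+_ xx₁≡k (d-link g (link-sym g lg))) (trans (+-comm k 1) (sym xx′≡)))
      y′≢x₁ : y′ ≢ x₁
      y′≢x₁ eq = x≁y (trans x~x₁ (trans (cong φ (sym eq)) (sym y~y′)))
      yx₁≡1+k : d y x₁ ≡ suc k
      yx₁≡1+k = trans (d-through-gate e (link-sym e le) (≢-sym x≁y) x~x₁) (cong suc xx₁≡k)
      slide : ∃[ t ] ∃[ g₁ ] ∃[ h₁ ] (Link H g₁ y′ t × Link H h₁ x₁ t × suc (d y t) ≡ d y y′) → Projective H e f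
      slide (t , g₁ , h₁ , lg₁ , lh₁ , yt<yy′) =
        links-between-components-projective k e h₁ le lh₁ x~x₁ (trans y~y′ (Q-link⇒φ≡ g₁ qg₁ lg₁)) x≁y xx₁≡k
        ◅◅ inj₁ (circuit-opposite square₂) ◅ ε
        where
        yt≡k : d y t ≡ k
        yt≡k = suc-injective (trans yt<yy′ yy′≡1+k)
        square₁ : FourCircuit x₁ x′ y′ t g f g₁ h₁
        square₁ = fourCircuit (≢-sym (link-irreflexive g lg)) (≢-sym y′≢x₁) (link-irreflexive h₁ lh₁)
                              (link-irreflexive f lf) (separated-by (d y) yx′≡2+k yt≡k (2+n≢n k)) (link-irreflexive g₁ lg₁)
                              (link-sym g lg) lf lg₁ (link-sym h₁ lh₁)
        qg₁ : Q g₁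
        qg₁ = circuit-Q square₁ (φ≡⇒Q g lg (trans (sym x~x′) x~x₁))
        square₂ : FourCircuit x₁ t y′ x′ h₁ g₁ f g
        square₂ = fourCircuit (link-irreflexive h₁ lh₁) (≢-sym y′≢x₁) (≢-sym (link-irreflexive g lg))
                              (≢-sym (link-irreflexive g₁ lg₁)) (separated-by (d y) yt≡k yx′≡2+k (≢-sym (2+n≢n k)))
                              (≢-sym (link-irreflexive f lf))
                              lh₁ (link-sym g₁ lg₁) (link-sym f lf) lg

  -- Lifting 4-circuits of H′

  V′ : Set
  V′ = Vertex H′

  record Distinct4 (c0 c1 c2 c3 : V′) : Set where
    constructor distinct4
    field
      c0≢c1 : c0 ≢ c1
      c0≢c2 : c0 ≢ c2
      c0≢c3 : c0 ≢ c3
      c1≢c2 : c1 ≢ c2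
      c1≢c3 : c1 ≢ c3
      c2≢c3 : c2 ≢ c3

  distinct4-rotate : ∀ {c0 c1 c2 c3} → Distinct4 c0 c1 c2 c3 → Distinct4 c1 c2 c3 c0
  distinct4-rotate (distinct4 n01 n02 n03 n12 n13 n23) = distinct4 n12 n13 (≢-sym n01) n23 (≢-sym n02) (≢-sym n03)

  distinct4-reflect : ∀ {c0 c1 c2 c3} → Distinct4 c0 c1 c2 c3 → Distinct4 c2 c1 c0 c3
  distinct4-reflect (distinct4 n01 n02 n03 n12 n13 n23) = distinct4 (≢-sym n12) (≢-sym n02) n23 (≢-sym n01) n13 n03

  record Span (c : V′) : Set where
    constructor span
    field
      enter leave : V
      enter∈ : φ enter ≡ c
      leave∈ : φ leave ≡ c
  open Span

  gap : ∀ {c} → Span c → ℕ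
  gap σ = d (enter σ) (leave σ)

  span-flip : ∀ {c} → Span c → Span c
  span-flip (span p q p∈ q∈) = span q p q∈ p∈

  -- Four edges of H joining the components c0, c1, c2, c3 cyclically; σᵢ records where this cycle
  -- enters and leaves cᵢ, and its gap is the distance between those two vertices.
  record Lift (c0 c1 c2 c3 : V′) : Set where
    constructor lift
    field
      σ0 : Span c0
      σ1 : Span c1
      σ2 : Span c2
      σ3 : Span c3
      e0 e1 e2 e3 : Edge H
      l0 : Link H e0 (leave σ0) (enter σ1)
      l1 : Link H e1 (leave σ1) (enter σ2)
      l2 : Link H e2 (leave σ2) (enter σ3)
      l3 : Link H e3 (leave σ3) (enter σ0)

  module _ {c0 c1 c2 c3 : V′} (L : Lift c0 c1 c2 c3) where
    open Lift L
    gap₀ gap₁ gap₂ gap₃ total-gap : ℕ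
    gap₀ = gap σ0
    gap₁ = gap σ1
    gap₂ = gap σ2
    gap₃ = gap σ3
    total-gap = gap₀ + gap₁ + gap₂ + gap₃

  lift-rotate : ∀ {c0 c1 c2 c3} → Lift c0 c1 c2 c3 → Lift c1 c2 c3 c0
  lift-rotate (lift σ0 σ1 σ2 σ3 e0 e1 e2 e3 l0 l1 l2 l3) = lift σ1 σ2 σ3 σ0 e1 e2 e3 e0 l1 l2 l3 l0

  lift-reflect : ∀ {c0 c1 c2 c3} → Lift c0 c1 c2 c3 → Lift c2 c1 c0 c3
  lift-reflect (lift σ0 σ1 σ2 σ3 e0 e1 e2 e3 l0 l1 l2 l3) =
    lift (span-flip σ2) (span-flip σ1) (span-flip σ0) (span-flip σ3) e1 e0 e3 e2
         (link-sym e1 l1) (link-sym e0 l0) (link-sym e3 l3) (link-sym e2 l2)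

  total-gap-rotate : ∀ {c0 c1 c2 c3} (L : Lift c0 c1 c2 c3) → total-gap (lift-rotate L) ≡ total-gap L
  total-gap-rotate L = solve 4 (λ a b c e → b :+ c :+ e :+ a := a :+ b :+ c :+ e) refl (gap₀ L) (gap₁ L) (gap₂ L) (gap₃ L)
    where open +-*-Solver

  gap-flip : ∀ {c} (σ : Span c) → gap (span-flip σ) ≡ gap σ
  gap-flip σ = d-sym (leave σ) (enter σ)

  total-gap-reflect : ∀ {c0 c1 c2 c3} (L : Lift c0 c1 c2 c3) → total-gap (lift-reflect L) ≡ total-gap L
  total-gap-reflect L = begin
    gap (span-flip σ2) + gap (span-flip σ1) + gap (span-flip σ0) + gap (span-flip σ3)
      ≡⟨ cong₂ _+_ (cong₂ _+_ (cong₂ _+_ (gap-flip σ2) (gap-flip σ1)) (gap-flip σ0)) (gap-flip σ3) ⟩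
    gap σ2 + gap σ1 + gap σ0 + gap σ3
      ≡⟨ solve 4 (λ a b c e → c :+ b :+ a :+ e := a :+ b :+ c :+ e) refl (gap σ0) (gap σ1) (gap σ2) (gap σ3) ⟩
    total-gap L
      ∎
    where
    open Lift L
    open +-*-Solver
    open ≡-Reasoning

  Realised : V′ → V′ → V′ → V′ → Set
  Realised c0 c1 c2 c3 = ∃[ v0 ] ∃[ v1 ] ∃[ v2 ] ∃[ v3 ] ∃[ e ] ∃[ g ] ∃[ f ] ∃[ h ]
    (FourCircuit v0 v1 v2 v3 e g f h × φ v0 ≡ c0 × φ v1 ≡ c1 × φ v2 ≡ c2 × φ v3 ≡ c3)

  realised-unrotate : ∀ {c0 c1 c2 c3} → Realised c1 c2 c3 c0 → Realised c0 c1 c2 c3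
  realised-unrotate (v1 , v2 , v3 , v0 , g , f , h , e , circuit , v1∈ , v2∈ , v3∈ , v0∈) =
    v0 , v1 , v2 , v3 , e , g , f , h , circuit-rotate (circuit-rotate (circuit-rotate circuit)) , v0∈ , v1∈ , v2∈ , v3∈

  Shrinks : ∀ {c0 c1 c2 c3} → Lift c0 c1 c2 c3 → Set
  Shrinks {c0} {c1} {c2} {c3} L = ∃[ L′ ] total-gap {c0} {c1} {c2} {c3} L′ < total-gap L

  Shortens₁ : ∀ {c0 c1 c2 c3} → Lift c0 c1 c2 c3 → Set
  Shortens₁ {c0} {c1} {c2} {c3} L =
    ∃[ L′ ] (total-gap {c0} {c1} {c2} {c3} L′ ≤ total-gap L × suc (gap₁ L′) ≡ gap₁ L × gap₃ L′ ≡ gap₃ L)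

  two-gaps-shrink : ∀ {a a′ b b′} c e → suc a′ ≡ a → suc b′ ≡ b → a′ + b′ + c + e < a + b + c + e
  two-gaps-shrink {a′ = a′} {b′ = b′} c e refl refl = +-monoˡ-< e (+-monoˡ-< c (+-mono-< (n<1+n a′) (n<1+n b′)))

  gap-traded : ∀ a {b b′ c c′} e → suc b′ ≡ b → c′ ≤ suc c → a + b′ + c′ + e ≤ a + b + c + e
  gap-traded a {b′ = b′} {c} {c′} e refl c′≤ = begin
    a + b′ + c′ + e       ≤⟨ +-monoˡ-≤ e (+-monoʳ-≤ (a + b′) c′≤) ⟩
    a + b′ + suc c + e    ≡⟨ cong (_+ e) (trans (+-suc (a + b′) c) (cong (_+ c) (sym (+-suc a b′)))) ⟩
    a + suc b′ + c + e    ∎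
    where open ≤-Reasoning

  -- Seen from q3 = leave σ3, either e0 or e1 can be slid towards p1 = enter σ1, or the gaps of σ2
  -- and σ3 together exceed those of σ0 and σ1.
  module GapStep {c0 c1 c2 c3} (distinct : Distinct4 c0 c1 c2 c3) (L : Lift c0 c1 c2 c3) where
    open Distinct4 distinct
    open Lift L

    p0 q0 p1 q1 p2 q2 p3 q3 : V
    p0 = enter σ0
    q0 = leave σ0
    p1 = enter σ1
    q1 = leave σ1
    p2 = enter σ2
    q2 = leave σ2
    p3 = enter σ3
    q3 = leave σ3

    k0 k1 k2 k3 : ℕ
    k0 = gap₀ L
    k1 = gap₁ L
    k2 = gap₂ L
    k3 = gap₃ L

    q3∉c0 : φ q3 ≢ φ p0
    q3∉c0 = separated-by id (leave∈ σ3) (enter∈ σ0) (≢-sym c0≢c3)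

    p0~q0 : φ p0 ≡ φ q0
    p0~q0 = trans (enter∈ σ0) (sym (leave∈ σ0))

    p1~q1 : φ p1 ≡ φ q1
    p1~q1 = trans (enter∈ σ1) (sym (leave∈ σ1))

    q3q0≡ : d q3 q0 ≡ suc k0
    q3q0≡ = d-through-gate e3 l3 q3∉c0 p0~q0

    q3p1≡ : d q3 p1 ≡ suc (suc k0)
    q3p1≡ = trans (d-leaving-component e3 e0 l3 q3∉c0 p0~q0 l0
                     (separated-by id (enter∈ σ1) (enter∈ σ0) (≢-sym c0≢c1))
                     (separated-by id (enter∈ σ1) (leave∈ σ3) c1≢c3))
                  (cong suc q3q0≡)

    q3p2≤ : d q3 p2 ≤ suc (k2 + k3)
    q3p2≤ = begin
      d q3 p2                     ≤⟨ d-triangle q3 p3 p2 ⟩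
      d q3 p3 + d p3 p2           ≤⟨ +-monoʳ-≤ (d q3 p3) (d-triangle p3 q2 p2) ⟩
      d q3 p3 + (d p3 q2 + d q2 p2) ≡⟨ cong₂ (λ a b → a + (d p3 q2 + b)) (d-sym q3 p3) (d-sym q2 p2) ⟩
      k3 + (d p3 q2 + k2)         ≡⟨ cong (λ z → k3 + (z + k2)) (d-link e2 (link-sym e2 l2)) ⟩
      k3 + suc k2                 ≡⟨ trans (+-suc k3 k2) (cong suc (+-comm k3 k2)) ⟩
      suc (k2 + k3)               ∎
      where open ≤-Reasoning

    slide-e0 : ∀ v r → Between H q3 v p1 → Between H p1 v q1 → d p1 v ≡ suc r → Shrinks L
    slide-e0 v r q3vp1 p1vq1 p1v≡ = towards-v (geodesic-first-step p1v≡)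
      where
      q3v+r≡ : d q3 v + r ≡ suc k0
      q3v+r≡ = suc-injective (begin
        suc (d q3 v + r)    ≡⟨ sym (+-suc (d q3 v) r) ⟩
        d q3 v + suc r      ≡⟨ cong (d q3 v +_) (trans (sym p1v≡) (d-sym p1 v)) ⟩
        d q3 v + d v p1     ≡⟨ between⇒d q3vp1 ⟩
        d q3 p1             ≡⟨ q3p1≡ ⟩
        suc (suc k0)        ∎)
        where open ≡-Reasoning
      towards-v : ∃[ b ] ∃[ g ] (Link H g p1 b × d b v ≡ r) → Shrinks L
      towards-v (b , g , lg , bv≡r) = close (quadrangle q3 g e0 lg (link-sym e0 l0) b≢q0 (trans q3b≡ (sym q3q0≡)))
        where
        q3b≡ : d q3 b ≡ suc k0
        q3b≡ = ≤-antisym (≤-trans (d-triangle q3 v b) (≤-reflexive (trans (cong (d q3 v +_) (trans (d-sym v b) bv≡r)) q3v+r≡)))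
                         (≤-pred (subst (_≤ suc (d q3 b)) q3p1≡ (d-link-step g q3 (link-sym g lg))))
        1+bq1≡k1 : suc (d b q1) ≡ k1
        1+bq1≡k1 = ≤-antisym (subst (suc (d b q1) ≤_) (trans (cong (_+ d v q1) (sym p1v≡)) (between⇒d p1vq1))
                                     (s≤s (≤-trans (d-triangle b v q1) (≤-reflexive (cong (_+ d v q1) bv≡r)))))
                             (subst₂ _≤_ (d-sym q1 p1) (cong suc (d-sym q1 b)) (d-link-step g q1 (link-sym g lg)))
        p1~b : φ p1 ≡ φ b
        p1~b = component-convex p1~q1 (trans (cong (_+ d b q1) (d-link g lg)) 1+bq1≡k1)
        b≢q0 : b ≢ q0
        b≢q0 = separated-by φ (trans (sym p1~b) (enter∈ σ1)) (leave∈ σ0) (≢-sym c0≢c1)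
        close : ∃[ t ] ∃[ h′ ] ∃[ g′ ] (Link H h′ b t × Link H g′ q0 t × suc (d q3 t) ≡ d q3 b) → Shrinks L
        close (t , h′ , g′ , lh′ , lg′ , q3t<q3b) =
          lift (span p0 t (enter∈ σ0) (trans (sym q0~t) (leave∈ σ0))) (span b q1 (trans (sym p1~b) (enter∈ σ1)) (leave∈ σ1))
               σ2 σ3 h′ e1 e2 e3 (link-sym h′ lh′) l1 l2 l3 ,
          two-gaps-shrink k2 k3 1+p0t≡k0 1+bq1≡k1
          where
          q3t≡k0 : d q3 t ≡ k0
          q3t≡k0 = suc-injective (trans q3t<q3b q3b≡)
          square : FourCircuit b p1 q0 t g e0 g′ h′
          square = fourCircuit (≢-sym (link-irreflexive g lg)) b≢q0 (link-irreflexive h′ lh′)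
                               (≢-sym (link-irreflexive e0 l0)) (separated-by (d q3) q3p1≡ q3t≡k0 (2+n≢n k0))
                               (link-irreflexive g′ lg′)
                               (link-sym g lg) (link-sym e0 l0) lg′ (link-sym h′ lh′)
          q0~t : φ q0 ≡ φ t
          q0~t = Q-link⇒φ≡ g′ (circuit-Q square (φ≡⇒Q g lg p1~b)) lg′
          1+p0t≡k0 : suc (d p0 t) ≡ k0
          1+p0t≡k0 = trans (sym (d-through-gate e3 l3 q3∉c0 (trans p0~q0 q0~t))) q3t≡k0

    slide-e1 : ∀ m → k1 ≡ suc m → d q3 q1 ≡ suc (suc (k0 + k1)) → d q3 q1 ≡ suc (d q3 p2) → Shortens₁ L
    slide-e1 m k1≡ q3q1≡ q3q1≡1+q3p2 = towards-p1 (geodesic-first-step (trans (d-sym q1 p1) k1≡))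
      where
      q3p2≡ : d q3 p2 ≡ suc (k0 + k1)
      q3p2≡ = suc-injective (trans (sym q3q1≡1+q3p2) q3q1≡)
      towards-p1 : ∃[ b ] ∃[ g ] (Link H g q1 b × d b p1 ≡ m) → Shortens₁ L
      towards-p1 (b , g , lg , bp1≡m) = close (quadrangle q3 e1 g l1 lg p2≢b (trans q3p2≡ (sym q3b≡)))
        where
        p1b≡m : d p1 b ≡ m
        p1b≡m = trans (d-sym p1 b) bp1≡m
        q3b≡ : d q3 b ≡ suc (k0 + k1)
        q3b≡ = ≤-antisym
          (begin
            d q3 b              ≤⟨ d-triangle q3 p1 b ⟩
            d q3 p1 + d p1 b    ≡⟨ cong₂ _+_ q3p1≡ p1b≡m ⟩
            suc (suc (k0 + m))  ≡⟨ cong suc (trans (sym (+-suc k0 m)) (cong (k0 +_) (sym k1≡))) ⟩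
            suc (k0 + k1)       ∎)
          (≤-pred (subst (_≤ suc (d q3 b)) q3q1≡ (d-link-step g q3 (link-sym g lg))))
          where open ≤-Reasoning
        p1~b : φ p1 ≡ φ b
        p1~b = component-convex p1~q1 (trans (cong₂ _+_ p1b≡m (d-link g (link-sym g lg))) (trans (+-comm m 1) (sym k1≡)))
        p2≢b : p2 ≢ b
        p2≢b = separated-by φ (enter∈ σ2) (trans (sym p1~b) (enter∈ σ1)) (≢-sym c1≢c2)
        close : ∃[ t ] ∃[ g′ ] ∃[ h′ ] (Link H g′ p2 t × Link H h′ b t × suc (d q3 t) ≡ d q3 p2) → Shortens₁ L
        close (t , g′ , h′ , lg′ , lh′ , q3t<q3p2) =
          lift σ0 (span p1 b (enter∈ σ1) (trans (sym p1~b) (enter∈ σ1))) (span t q2 (trans (sym p2~t) (enter∈ σ2)) (leave∈ σ2))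
               σ3 e0 h′ e2 e3 l0 lh′ l2 l3 ,
          gap-traded k0 k3 1+p1b≡k1 tq2≤ , 1+p1b≡k1 , refl
          where
          q3t≡ : d q3 t ≡ k0 + k1
          q3t≡ = suc-injective (trans q3t<q3p2 q3p2≡)
          square : FourCircuit b q1 p2 t g e1 g′ h′
          square = fourCircuit (≢-sym (link-irreflexive g lg)) (≢-sym p2≢b) (link-irreflexive h′ lh′)
                               (link-irreflexive e1 l1) (separated-by (d q3) q3q1≡ q3t≡ (2+n≢n (k0 + k1)))
                               (link-irreflexive g′ lg′)
                               (link-sym g lg) l1 lg′ (link-sym h′ lh′)
          p2~t : φ p2 ≡ φ t
          p2~t = Q-link⇒φ≡ g′ (circuit-Q square (φ≡⇒Q g lg (trans (sym p1~q1) p1~b))) lg′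
          1+p1b≡k1 : suc (d p1 b) ≡ k1
          1+p1b≡k1 = trans (cong suc p1b≡m) (sym k1≡)
          tq2≤ : d t q2 ≤ suc k2
          tq2≤ = ≤-trans (d-triangle t p2 q2) (≤-reflexive (cong (_+ k2) (d-link g′ (link-sym g′ lg′))))

    gap-step : ∀ m → k1 ≡ suc m →
               Shrinks L ⊎ (k0 + k1 ≤ k2 + k3 × (suc (suc (k0 + k1)) ≤ k2 + k3 ⊎ Shortens₁ L))
    gap-step m k1≡ with median q3 p1 q1
    ... | v , q3vp1 , p1vq1 , q3vq1 with d p1 v in p1v≡
    ... | suc r = inj₁ (slide-e0 v r q3vp1 p1vq1 p1v≡)
    ... | zero with d≡0⇒≡ p1v≡
    ...   | refl = inj₂ (≤-pred (≤-pred (subst (_≤ suc (suc (k2 + k3))) q3q1≡ q3q1≤)) , beyond-or-slide)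
      where
      q3q1≡ : d q3 q1 ≡ suc (suc (k0 + k1))
      q3q1≡ = trans (sym (between⇒d q3vq1)) (cong (_+ k1) q3p1≡)
      q3q1≤ : d q3 q1 ≤ suc (suc (k2 + k3))
      q3q1≤ = ≤-trans (d-link-step e1 q3 (link-sym e1 l1)) (s≤s q3p2≤)
      beyond-or-slide : suc (suc (k0 + k1)) ≤ k2 + k3 ⊎ Shortens₁ L
      beyond-or-slide with link-d-cases e1 q3 l1
      ... | inj₁ q3p2≡ = inj₁ (≤-pred (subst (_≤ suc (k2 + k3)) (trans q3p2≡ (cong suc q3q1≡)) q3p2≤))
      ... | inj₂ q3q1≡1+q3p2 = inj₂ (slide-e1 m k1≡ q3q1≡ q3q1≡1+q3p2)

  shrinks-or-gap₁≤gap₃ :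
    ∀ {c0 c1 c2 c3} → Distinct4 c0 c1 c2 c3 → (L : Lift c0 c1 c2 c3) → ∀ m → gap₁ L ≡ suc m →
    Shrinks L ⊎ (gap₁ L ≤ gap₃ L × ∃[ L′ ] (total-gap {c0} {c1} {c2} {c3} L′ ≤ total-gap L × gap₁ L′ < gap₃ L′))
  shrinks-or-gap₁≤gap₃ distinct L m k1≡
    with GapStep.gap-step distinct L m k1≡
       | GapStep.gap-step (distinct4-reflect distinct) (lift-reflect L) m (trans (gap-flip (Lift.σ1 L)) k1≡)
  ... | inj₁ shrinks | _ = inj₁ shrinks
  ... | inj₂ _ | inj₁ (L′ , smaller) =
    inj₁ (lift-reflect L′ , subst₂ _<_ (sym (total-gap-reflect L′)) (total-gap-reflect L) smaller)
  ... | inj₂ (balanced , outcome) | inj₂ (balanced′ , _) = inj₂ (k1≤k3 , witness outcome)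
    where
    k0 k1 k2 k3 : ℕ
    k0 = gap₀ L
    k1 = gap₁ L
    k2 = gap₂ L
    k3 = gap₃ L
    k2+k1≤k0+k3 : k2 + k1 ≤ k0 + k3
    k2+k1≤k0+k3 = subst₂ _≤_ (cong₂ _+_ (gap-flip (Lift.σ2 L)) (gap-flip (Lift.σ1 L)))
                             (cong₂ _+_ (gap-flip (Lift.σ0 L)) (gap-flip (Lift.σ3 L))) balanced′
    k1≤k3 : k1 ≤ k3
    k1≤k3 = crossed-sums k0 k1 k2 k3 balanced k2+k1≤k0+k3
    witness : suc (suc (k0 + k1)) ≤ k2 + k3 ⊎ Shortens₁ L →
              ∃[ L′ ] (total-gap L′ ≤ total-gap L × gap₁ L′ < gap₃ L′)
    witness (inj₁ beyond) =
      L , ≤-refl , crossed-sums (suc k0) (suc k1) k2 k3 (subst (_≤ k2 + k3) (cong suc (sym (+-suc k0 k1))) beyond)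
                                (subst (_≤ suc (k0 + k3)) (sym (+-suc k2 k1)) (s≤s k2+k1≤k0+k3))
    witness (inj₂ (L′ , L′≤ , shorter₁ , same₃)) = L′ , L′≤ , subst₂ _≤_ (sym shorter₁) (sym same₃) k1≤k3

  zero-gaps-realised : ∀ {c0 c1 c2 c3} → Distinct4 c0 c1 c2 c3 → (L : Lift c0 c1 c2 c3) →
                       gap₀ L ≡ 0 → gap₁ L ≡ 0 → gap₂ L ≡ 0 → gap₃ L ≡ 0 → Realised c0 c1 c2 c3
  zero-gaps-realised (distinct4 n01 n02 n03 n12 n13 n23)
                     (lift (span p0 q0 p0∈ q0∈) (span p1 q1 p1∈ q1∈) (span p2 q2 p2∈ q2∈) (span p3 q3 p3∈ q3∈)
                           e0 e1 e2 e3 l0 l1 l2 l3)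
                     k0≡0 k1≡0 k2≡0 k3≡0
    with d≡0⇒≡ k0≡0 | d≡0⇒≡ k1≡0 | d≡0⇒≡ k2≡0 | d≡0⇒≡ k3≡0
  ... | refl | refl | refl | refl =
    q0 , q1 , q2 , q3 , e0 , e1 , e2 , e3 ,
    fourCircuit (separated-by φ q0∈ q1∈ n01) (separated-by φ q0∈ q2∈ n02) (separated-by φ q0∈ q3∈ n03)
                (separated-by φ q1∈ q2∈ n12) (separated-by φ q1∈ q3∈ n13) (separated-by φ q2∈ q3∈ n23)
                l0 l1 l2 l3 ,
    q0∈ , q1∈ , q2∈ , q3∈

  rotate-bound : ∀ {n c0 c1 c2 c3} (L : Lift c0 c1 c2 c3) → total-gap L < n → total-gap (lift-rotate L) < n
  rotate-bound {n} L = subst (_< n) (sym (total-gap-rotate L))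

  -- Induction on the total gap, which is below the fuel n.
  realise : ∀ n {c0 c1 c2 c3} → Distinct4 c0 c1 c2 c3 → (L : Lift c0 c1 c2 c3) → total-gap L < n →
            Realised c0 c1 c2 c3
  realise-gap₁ : ∀ n {c0 c1 c2 c3} → Distinct4 c0 c1 c2 c3 → (L : Lift c0 c1 c2 c3) → ∀ m → gap₁ L ≡ suc m →
                 total-gap L < n → Realised c0 c1 c2 c3

  realise n distinct L bound
    with zero-or-suc (gap₁ L) | zero-or-suc (gap₂ L) | zero-or-suc (gap₃ L) | zero-or-suc (gap₀ L)
  ... | inj₂ (m , k1≡) | _ | _ | _ = realise-gap₁ n distinct L m k1≡ bound
  ... | inj₁ _ | inj₂ (m , k2≡) | _ | _ =
    realised-unrotate (realise-gap₁ n (distinct4-rotate distinct) (lift-rotate L) m k2≡ (rotate-bound L bound))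
  ... | inj₁ _ | inj₁ _ | inj₂ (m , k3≡) | _ =
    realised-unrotate (realised-unrotate
      (realise-gap₁ n (distinct4-rotate (distinct4-rotate distinct)) (lift-rotate (lift-rotate L)) m k3≡
                    (rotate-bound (lift-rotate L) (rotate-bound L bound))))
  ... | inj₁ _ | inj₁ _ | inj₁ _ | inj₂ (m , k0≡) =
    realised-unrotate (realised-unrotate (realised-unrotate
      (realise-gap₁ n (distinct4-rotate (distinct4-rotate (distinct4-rotate distinct)))
                    (lift-rotate (lift-rotate (lift-rotate L))) m k0≡
                    (rotate-bound (lift-rotate (lift-rotate L)) (rotate-bound (lift-rotate L) (rotate-bound L bound))))))
  ... | inj₁ k1≡0 | inj₁ k2≡0 | inj₁ k3≡0 | inj₁ k0≡0 = zero-gaps-realised distinct L k0≡0 k1≡0 k2≡0 k3≡0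

  -- For L′ turned by two places, the second alternative would give gap₃ L′ ≤ gap₁ L′.
  realise-gap₁ zero distinct L m k1≡ ()
  realise-gap₁ (suc n) distinct L m k1≡ bound with shrinks-or-gap₁≤gap₃ distinct L m k1≡
  ... | inj₁ (L′ , smaller) = realise n distinct L′ (<-≤-trans smaller (≤-pred bound))
  ... | inj₂ (_ , L′ , L′≤L , k1′<k3′) with zero-or-suc (gap₃ L′)
  ...   | inj₁ k3′≡0 = ⊥-elim (n≮0 (subst (gap₁ L′ <_) k3′≡0 k1′<k3′))
  ...   | inj₂ (m′ , k3′≡)
          with shrinks-or-gap₁≤gap₃ (distinct4-rotate (distinct4-rotate distinct)) (lift-rotate (lift-rotate L′)) m′ k3′≡
  ...     | inj₂ (k3′≤k1′ , _) = ⊥-elim (<⇒≱ k1′<k3′ k3′≤k1′)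
  ...     | inj₁ (L″ , smaller) =
    realised-unrotate (realised-unrotate (realise n (distinct4-rotate (distinct4-rotate distinct)) L″ L″-bound))
    where
    L″-bound : total-gap L″ < n
    L″-bound = <-≤-trans smaller (≤-trans (≤-reflexive (trans (total-gap-rotate (lift-rotate L′)) (total-gap-rotate L′)))
                                          (≤-trans L′≤L (≤-pred bound)))

  -- Projectivity in H and in H′

  circuit-diagonal : ∀ {v0 v1 v2 v3 e g f h} → FourCircuit v0 v1 v2 v3 e g f h → φ v0 ≢ φ v1 → φ v0 ≢ φ v2
  circuit-diagonal {v0} {v1} {v2} {e = e} {g} (fourCircuit _ v0≢v2 _ _ _ _ le lg _ _) v0≁v1 v0~v2 =
    v0≁v1 (component-convex v0~v2 (trans (cong₂ _+_ (d-link e le) (d-link g lg)) (sym v0v2≡2)))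
    where
    v0v2≡2 : d v0 v2 ≡ 2
    v0v2≡2 = d-common-neighbour v0≢v2 (λ f l → link⇒d-≢ f v1 l (trans (d-link e (link-sym e le)) (sym (d-link g lg))))
                                e g le lg

  push-link : ∀ e′ {x y} → Link H (ι e′) x y → Link H′ e′ (φ x) (φ y)
  push-link e′ (inj₁ p) = inj₁ (trans (ι-ends e′) (cong (map φ φ) p))
  push-link e′ (inj₂ p) = inj₂ (trans (ι-ends e′) (cong (map φ φ) p))

  lift-link : ∀ e′ {u v} → Link H′ e′ u v → ∃[ x ] ∃[ y ] (Link H (ι e′) x y × φ x ≡ u × φ y ≡ v)
  lift-link e′ {u} {v} (inj₁ p) = x , y , inj₁ refl , ,-injectiveˡ xy↦uv , ,-injectiveʳ xy↦uv
    where
    x = proj₁ (ends H (ι e′))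
    y = proj₂ (ends H (ι e′))
    xy↦uv : (φ x , φ y) ≡ (u , v)
    xy↦uv = trans (sym (ι-ends e′)) p
  lift-link e′ {u} {v} (inj₂ p) = y , x , inj₂ refl , ,-injectiveʳ xy↦vu , ,-injectiveˡ xy↦vu
    where
    x = proj₁ (ends H (ι e′))
    y = proj₂ (ends H (ι e′))
    xy↦vu : (φ x , φ y) ≡ (v , u)
    xy↦vu = trans (sym (ι-ends e′)) p

  ι-crosses : ∀ e′ {x y} → Link H (ι e′) x y → φ x ≢ φ y
  ι-crosses e′ l eq = ι-out e′ (φ≡⇒Q (ι e′) l eq)

  mates′⇒projective : ∀ {e′ f′} → Mates H′ e′ f′ → Projective H (ι e′) (ι f′)
  mates′⇒projective {e′} {f′} (inj₂ (_ , _ , _ , le′ , lf′)) with lift-link e′ le′ | lift-link f′ lf′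
  ... | x , y , le , x∈ , y∈ | x′ , y′ , lf , x′∈ , y′∈ =
    links-between-components-projective _ (ι e′) (ι f′) le lf (trans x∈ (sym x′∈)) (trans y∈ (sym y′∈))
                                        (ι-crosses e′ le) refl
  mates′⇒projective {e′} {f′}
    (inj₁ (u0 , u1 , u2 , u3 , g′ , h′ , n01 , n02 , n03 , n12 , n13 , n23 , le′ , lg′ , lf′ , lh′))
    with lift-link e′ le′ | lift-link g′ lg′ | lift-link f′ lf′ | lift-link h′ lh′
  ... | x0 , y1 , l0 , x0∈ , y1∈ | x1 , y2 , l1 , x1∈ , y2∈ | x2 , y3 , l2 , x2∈ , y3∈ | x3 , y0 , l3 , x3∈ , y0∈ =
    through-circuit (realise (suc (total-gap L)) (distinct4 n01 n02 n03 n12 n13 n23) L ≤-refl)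
    where
    L : Lift u0 u1 u2 u3
    L = lift (span y0 x0 y0∈ x0∈) (span y1 x1 y1∈ x1∈) (span y2 x2 y2∈ x2∈) (span y3 x3 y3∈ x3∈)
             (ι e′) (ι g′) (ι f′) (ι h′) l0 l1 l2 l3
    through-circuit : Realised u0 u1 u2 u3 → Projective H (ι e′) (ι f′)
    through-circuit (v0 , v1 , v2 , v3 , e , g , f , h , circuit , v0∈ , v1∈ , v2∈ , v3∈) =
      links-between-components-projective _ (ι e′) e l0 (FourCircuit.link-e circuit)
        (trans x0∈ (sym v0∈)) (trans y1∈ (sym v1∈)) (ι-crosses e′ l0) refl
      ◅◅ inj₁ (circuit-opposite circuit) ◅
      links-between-components-projective _ f (ι f′) (FourCircuit.link-f circuit) l2
        (trans v2∈ (sym x2∈)) (trans v3∈ (sym y3∈)) (separated-by id v2∈ v3∈ n23) refl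

  mates⇒projective′ : ∀ {a′ b′} → Mates H (ι a′) (ι b′) → Projective H′ a′ b′
  mates⇒projective′ (inj₂ (a≢b , _ , _ , la , lb)) = ⊥-elim (a≢b (link-unique _ _ la lb))
  mates⇒projective′ {a′} {b′} (inj₁ (v0 , v1 , v2 , v3 , g , h , n01 , n02 , n03 , n12 , n13 , n23 , la , lg , lb , lh))
    with φ v1 Fin.≟ φ v2
  ... | yes v1~v2 = inj₂ (a′≢b′ , φ v0 , φ v1 , push-link a′ la , lb′) ◅ ε
    where
    circuit : FourCircuit v0 v1 v2 v3 (ι a′) g (ι b′) h
    circuit = fourCircuit n01 n02 n03 n12 n13 n23 la lg lb lh
    v3~v0 : φ v3 ≡ φ v0
    v3~v0 = Q-link⇒φ≡ h (circuit-Q′ circuit (φ≡⇒Q g lg v1~v2)) lh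
    a′≢b′ : a′ ≢ b′
    a′≢b′ refl = [ n02 , n03 ]′ (link-endpoint (ι a′) la lb)
    lb′ : Link H′ b′ (φ v0) (φ v1)
    lb′ = GraphFacts.link-sym H′ b′ (subst₂ (Link H′ b′) (sym v1~v2) v3~v0 (push-link b′ lb))
  ... | no v1≁v2 =
    inj₁ (φ v0 , φ v1 , φ v2 , φ v3 , g′ , h′ , v0≁v1 , circuit-diagonal circuit v0≁v1 , ≢-sym v3≁v0 ,
          v1≁v2 , circuit-diagonal (circuit-rotate circuit) v1≁v2 , ι-crosses b′ lb ,
          push-link a′ la , push-link g′ lg′ , push-link b′ lb , push-link h′ lh′) ◅ ε
    where
    circuit : FourCircuit v0 v1 v2 v3 (ι a′) g (ι b′) h
    circuit = fourCircuit n01 n02 n03 n12 n13 n23 la lg lb lh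
    g∉Q : ¬ Q g
    g∉Q q = v1≁v2 (Q-link⇒φ≡ g q lg)
    h∉Q : ¬ Q h
    h∉Q q = g∉Q (circuit-Q′ (circuit-rotate (circuit-rotate circuit)) q)
    v0≁v1 : φ v0 ≢ φ v1
    v0≁v1 = ι-crosses a′ la
    v3≁v0 : φ v3 ≢ φ v0
    v3≁v0 = h∉Q ∘ φ≡⇒Q h lh
    g′ h′ : Edge H′
    g′ = proj₁ (ι-onto g g∉Q)
    h′ = proj₁ (ι-onto h h∉Q)
    lg′ : Link H (ι g′) v1 v2
    lg′ = subst (λ z → Link H z v1 v2) (sym (proj₂ (ι-onto g g∉Q))) lg
    lh′ : Link H (ι h′) v3 v0
    lh′ = subst (λ z → Link H z v3 v0) (sym (proj₂ (ι-onto h h∉Q))) lh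

  projective′⇒projective : ∀ {e′ f′} → Projective H′ e′ f′ → Projective H (ι e′) (ι f′)
  projective′⇒projective ε = ε
  projective′⇒projective (m ◅ p) = mates′⇒projective m ◅◅ projective′⇒projective p

  projective⇒projective′ : ∀ {a b} → Projective H a b →
                           ∀ a′ b′ → ι a′ ≡ a → ι b′ ≡ b → Projective H′ a′ b′
  projective⇒projective′ ε a′ b′ refl b≡ = subst (Projective H′ a′) (ι-inj a′ b′ (sym b≡)) ε
  projective⇒projective′ (_◅_ {j = c} m p) a′ b′ refl b≡ =
    mates⇒projective′ (subst (Mates H (ι a′)) (sym c≡) m) ◅◅ projective⇒projective′ p c′ b′ c≡ b≡
    where
    c∉Q : ¬ Q c
    c∉Q qc = ι-out a′ (Q-closed qc (mates-sym m))
    c′ : Edge H′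
    c′ = proj₁ (ι-onto c c∉Q)
    c≡ : ι c′ ≡ c
    c≡ = proj₂ (ι-onto c c∉Q)

  disjoint-orbit⇒contracted-orbit : ∀ (O : Pred (Edge H) 0ℓ) → IsOrbit H O → (∀ e → O e → ¬ Q e) →
                                    IsOrbit H′ (λ e′ → O (ι e′))
  disjoint-orbit⇒contracted-orbit O ((e , oe) , orbit) disjoint =
    (proj₁ (ι-onto e (disjoint e oe)) , subst O (sym (proj₂ (ι-onto e (disjoint e oe)))) oe) ,
    λ e′ f′ oe′ → mk⇔ (λ of′ → projective⇒projective′ (Equivalence.to (orbit (ι e′) (ι f′) oe′) of′)
                                                      e′ f′ refl refl)
                      (Equivalence.from (orbit (ι e′) (ι f′) oe′) ∘ projective′⇒projective)

  contracted-orbit⇒orbit : ∀ (O′ : Pred (Edge H′) 0ℓ) → IsOrbit H′ O′ →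
                           ∃[ O ] (IsOrbit H O × (∀ e → O e → ¬ Q e) × (∀ e′ → O′ e′ ⇔ O (ι e′)))
  contracted-orbit⇒orbit O′ ((e₀′ , oe₀′) , orbit′) =
    Projective H (ι e₀′) ,
    ((ι e₀′ , ε) , λ e f p → mk⇔ (projective-sym p ◅◅_) (p ◅◅_)) ,
    (λ e p qe → ι-out e₀′ (projective-closed Q-closed qe (projective-sym p))) ,
    (λ e′ → mk⇔ (projective′⇒projective ∘ Equivalence.to (orbit′ e₀′ e′ oe₀′))
                (λ p → Equivalence.from (orbit′ e₀′ e′ oe₀′) (projective⇒projective′ p e₀′ e′ refl refl)))

mainTheorem3 : (H : MultiGraph) → Modular H
    → (Q₁ : Pred (Edge H) 0ℓ) → IsOrbit H Q₁
    → (H' : MultiGraph) (φ : Vertex H → Vertex H') (ι : Edge H' → Edge H)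
    → IsContraction H Q₁ H' φ ι
    → (∀ (Q : Pred (Edge H) 0ℓ) → IsOrbit H Q → (∀ e → Q e → ¬ Q₁ e) → IsOrbit H' (λ e' → Q (ι e')))
      × (∀ (Q' : Pred (Edge H') 0ℓ) → IsOrbit H' Q'
           → ∃[ Q ] (IsOrbit H Q × (∀ e → Q e → ¬ Q₁ e) × (∀ e' → Q' e' ⇔ Q (ι e'))))
mainTheorem3 H modular Q₁ orbit H′ φ ι contraction = disjoint-orbit⇒contracted-orbit , contracted-orbit⇒orbit
  where open Contraction H modular Q₁ (orbit-mate-closed orbit) H′ φ ι contraction
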